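{- For $n\ge1$ let $\phi(n)=|\tau(\mathbf{t}^<_{n-1})0|+1$. If $\Psi_{\mathbf{t}}(n)\cap B(n)\ne\emptyset$, then $\Psi_{\mathbf{t}}(\phi(n))\cap B(\phi(n))\ne\emptyset$.
   Context: Let $\tau$ be the morphism on $\{0,1,2\}^*$ given by $0\mapsto 01$, $1\mapsto 02$, $2\mapsto 0$, and let $\mathbf{t}=\lim_{n\to\infty}\tau^n(0)$ be its fixed point (the Tribonacci word). For a word $u$, $\Psi(u)=(|u|_0,|u|_1,|u|_2)$ is its Parikh vector ($|u|_a$ = number of occurrences of $a$), and $\Psi_{\mathbf{t}}(n)$ is the set of Parikh vectors of factors of $\mathbf{t}$ of length $n$. A factor $u$ is right special if $ua$ and $ub$ are factors for two distinct letters $a,b$; it is known that for each $n\ge1$, $\mathbf{t}$ has exactly one right special factor of length $n-1$, denoted $\mathbf{t}^<_{n-1}$. Writing $\Psi(\mathbf{t}^<_{n-1})=(i,j,k)$, set $B(n)=\{(i-1,j+1,k+1),(i+1,j-1,k+1),(i+1,j+1,k-1)\}$. -}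

module Defs where

open import Data.Nat using (ℕ; zero; suc; _+_)
open import Data.List using (List; []; _∷_; _++_; [_]; length; map; concatMap; upTo)
open import Data.Product using (_×_; _,_; ∃; ∃-syntax)
open import Data.Sum using (_⊎_)
open import Relation.Binary.PropositionalEquality using (_≡_)
open import Relation.Nullary using (¬_)

data Letter : Set where
  a0 a1 a2 : Letter

Word : Set
Word = List Letter

τL : Letter → Word
τL a0 = a0 ∷ a1 ∷ []
τL a1 = a0 ∷ a2 ∷ []
τL a2 = a0 ∷ []

τ : Word → Word
τ = concatMap τL

τ^ : ℕ → Word → Word
τ^ zero w = w
τ^ (suc n) w = τ (τ^ n w)

at : Word → ℕ → Letter
at [] _ = a0
at (x ∷ xs) zero = x
at (x ∷ xs) (suc i) = at xs i

-- The Tribonacci word t = lim τ^n(0), as a function ℕ → Letter.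
-- τ^i(0) is a prefix of t of length ≥ i+1, so its i-th letter is t(i).
t : ℕ → Letter
t i = at (τ^ i (a0 ∷ [])) i

slice : ℕ → ℕ → Word
slice i n = map (λ j → t (i + j)) (upTo n)

Factor : Word → Set
Factor u = ∃[ i ] slice i (length u) ≡ u

RightSpecial : Word → Set
RightSpecial u = ∃[ a ] ∃[ b ] (¬ a ≡ b × Factor (u ++ [ a ]) × Factor (u ++ [ b ]))

count0 count1 count2 : Word → ℕ
count0 [] = 0
count0 (a0 ∷ w) = suc (count0 w)
count0 (_ ∷ w) = count0 w
count1 [] = 0
count1 (a1 ∷ w) = suc (count1 w)
count1 (_ ∷ w) = count1 w
count2 [] = 0
count2 (a2 ∷ w) = suc (count2 w)
count2 (_ ∷ w) = count2 w

Ψ : Word → ℕ × ℕ × ℕ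
Ψ w = count0 w , count1 w , count2 w

-- p ∈ B given Ψ(r) = (i,j,k) for the right special factor r:
-- B = {(i-1,j+1,k+1),(i+1,j-1,k+1),(i+1,j+1,k-1)}  (written without truncated subtraction)
InB : ℕ × ℕ × ℕ → ℕ × ℕ × ℕ → Set
InB (i , j , k) (x , y , z) =
    (x + 1 ≡ i × y ≡ j + 1 × z ≡ k + 1)
  ⊎ (x ≡ i + 1 × y + 1 ≡ j × z ≡ k + 1)
  ⊎ (x ≡ i + 1 × y ≡ j + 1 × z + 1 ≡ k)

-- Ψ_t(n) ∩ B(n) ≠ ∅, where r is the right special factor of length n-1
MeetsB : ℕ → Word → Set
MeetsB n r = ∃[ u ] (Factor u × length u ≡ n × InB (Ψ r) (Ψ u))

φ : Word → ℕ
φ r = length (τ r ++ [ a0 ]) + 1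

-- Any two right special factors of t are suffixes of a common word, so right special factors of
-- equal length coincide. Indeed a nonempty right special factor ends in 0, say v0, and then τ⁻¹(v)
-- is a shorter right special factor with v0 a suffix of τ(τ⁻¹(v))0; comparing the two shorter
-- factors and applying w ↦ τ(w)0 gives the claim by induction. As r ↦ τ(r)0 preserves right
-- specialness, the right special factor of length φ(n) - 1 is τ(r)0. Finally u ↦ τ(u)0 preserves
-- factors and maps Parikh vectors (x, y, z) to (|u| + 1, x, y): it carries the first two points of
-- B(n) to the last two of B(φ(n)), and for the third point, dropping the leading 0 of τ(u) lands on
-- the first one.
module Submission where

open import Defs
open import Data.Nat using (ℕ; zero; suc; _+_; _∸_; _≤_; _<_; z≤n; s≤s)
open import Data.Nat.Properties
  using (+-comm; +-suc; +-identityʳ; +-monoʳ-≤; +-monoʳ-<; +-mono-<; ≤-trans; <⇒≤;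
         m<n⇒m<1+n; m+n≤o⇒m≤o∸n; m+n∸n≡m; m≢1+n+m; m+1+n≢0; module ≤-Reasoning)
open import Data.Nat.Induction using (<-wellFounded)
open import Data.Nat.Tactic.RingSolver using (solve)
open import Induction.WellFounded using (Acc; acc)
open import Data.List using ([]; _∷_; _++_; [_]; _∷ʳ_; length; applyUpTo; take; drop; initLast; _∷ʳ′_)
open import Data.List.Properties
  using (++-assoc; ++-identityʳ; ∷-injective; ∷-injectiveˡ; ∷-injectiveʳ; ∷ʳ-++; length-++; length-++-≤ˡ;
         length-++-sucʳ; length-drop; take++drop≡id; concatMap-++; map-upTo)
open import Data.Product using (_×_; _,_; ∃-syntax; proj₁; proj₂)
open import Data.Sum using (inj₁; inj₂)
open import Data.Empty using (⊥-elim)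
open import Function using (_∘_)
open import Relation.Nullary using (¬_)
open import Relation.Binary.PropositionalEquality
  using (_≡_; _≢_; refl; sym; trans; cong; cong₂; subst; subst₂; module ≡-Reasoning)

tPrefix : ℕ → Word
tPrefix N = τ^ N (a0 ∷ [])

τ-∷ : ∀ x xs → ∃[ w ] τ (x ∷ xs) ≡ a0 ∷ w
τ-∷ a0 xs = _ , refl
τ-∷ a1 xs = _ , refl
τ-∷ a2 xs = _ , refl

tPrefix-suc : ∀ N → ∃[ z ] ∃[ zs ] tPrefix (suc N) ≡ tPrefix N ++ z ∷ zs
tPrefix-suc zero = a1 , [] , refl
tPrefix-suc (suc N)
  with z , zs , eq ← tPrefix-suc N
  with w , eq′ ← τ-∷ z zs
  = a0 , w , (begin
    τ (tPrefix (suc N))            ≡⟨ cong τ eq ⟩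
    τ (tPrefix N ++ z ∷ zs)        ≡⟨ concatMap-++ τL (tPrefix N) (z ∷ zs) ⟩
    tPrefix (suc N) ++ τ (z ∷ zs)  ≡⟨ cong (tPrefix (suc N) ++_) eq′ ⟩
    tPrefix (suc N) ++ a0 ∷ w      ∎)
  where open ≡-Reasoning

tPrefix-+ : ∀ j k → ∃[ zs ] tPrefix (j + k) ≡ tPrefix j ++ zs
tPrefix-+ j zero = [] , trans (cong tPrefix (+-identityʳ j)) (sym (++-identityʳ (tPrefix j)))
tPrefix-+ j (suc k)
  with zs , eq ← tPrefix-+ j k
  with z , zs′ , eq′ ← tPrefix-suc (j + k)
  = zs ++ z ∷ zs′ , (begin
    tPrefix (j + suc k)           ≡⟨ cong tPrefix (+-suc j k) ⟩
    tPrefix (suc (j + k))         ≡⟨ eq′ ⟩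
    tPrefix (j + k) ++ z ∷ zs′    ≡⟨ cong (_++ z ∷ zs′) eq ⟩
    (tPrefix j ++ zs) ++ z ∷ zs′  ≡⟨ ++-assoc (tPrefix j) zs (z ∷ zs′) ⟩
    tPrefix j ++ zs ++ z ∷ zs′    ∎)
  where open ≡-Reasoning

length-tPrefix : ∀ N → N < length (tPrefix N)
length-tPrefix zero = s≤s z≤n
length-tPrefix (suc N) with z , zs , eq ← tPrefix-suc N = begin-strict
  suc N                             <⟨ s≤s (length-tPrefix N) ⟩
  suc (length (tPrefix N))          ≤⟨ s≤s (length-++-≤ˡ (tPrefix N)) ⟩
  suc (length (tPrefix N ++ zs))    ≡⟨ length-++-sucʳ (tPrefix N) z zs ⟨
  length (tPrefix N ++ z ∷ zs)      ≡⟨ cong length eq ⟨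
  length (tPrefix (suc N))          ∎
  where open ≤-Reasoning

at-++ˡ : ∀ xs ys {j} → j < length xs → at (xs ++ ys) j ≡ at xs j
at-++ˡ (x ∷ xs) ys {zero}  _         = refl
at-++ˡ (x ∷ xs) ys {suc j} (s≤s j<) = at-++ˡ xs ys j<

at-drop : ∀ i W k → at (drop i W) k ≡ at W (i + k)
at-drop zero    W       k = refl
at-drop (suc i) []      k = refl
at-drop (suc i) (x ∷ W) k = at-drop i W k

t-tPrefix : ∀ N {j} → j < length (tPrefix N) → t j ≡ at (tPrefix N) j
t-tPrefix N {j} j< with zs , eq ← tPrefix-+ j N | zs′ , eq′ ← tPrefix-+ N j = begin
  at (tPrefix j) j          ≡⟨ at-++ˡ (tPrefix j) zs (length-tPrefix j) ⟨
  at (tPrefix j ++ zs) j    ≡⟨ cong (λ w → at w j) eq ⟨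
  at (tPrefix (j + N)) j    ≡⟨ cong (λ n → at (tPrefix n) j) (+-comm j N) ⟩
  at (tPrefix (N + j)) j    ≡⟨ cong (λ w → at w j) eq′ ⟩
  at (tPrefix N ++ zs′) j   ≡⟨ at-++ˡ (tPrefix N) zs′ j< ⟩
  at (tPrefix N) j          ∎
  where open ≡-Reasoning

applyUpTo-take : ∀ (f : ℕ → Letter) m W → m ≤ length W → (∀ k → k < m → f k ≡ at W k) →
                 applyUpTo f m ≡ take m W
applyUpTo-take f zero    W       _        _     = refl
applyUpTo-take f (suc m) (w ∷ W) (s≤s m≤) agree =
  cong₂ _∷_ (agree 0 (s≤s z≤n)) (applyUpTo-take (f ∘ suc) m W m≤ (λ k k< → agree (suc k) (s≤s k<)))

slice-tPrefix : ∀ N i m → i + m ≤ length (tPrefix N) → slice i m ≡ take m (drop i (tPrefix N))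
slice-tPrefix N i m bound =
  trans (map-upTo (λ j → t (i + j)) m) (applyUpTo-take (λ j → t (i + j)) m (drop i P) m≤ agree)
  where
  P : Word
  P = tPrefix N
  m≤ : m ≤ length (drop i P)
  m≤ = subst (m ≤_) (sym (length-drop i P)) (m+n≤o⇒m≤o∸n m (subst (_≤ length P) (+-comm i m) bound))
  agree : ∀ k → k < m → t (i + k) ≡ at (drop i P) k
  agree k k< = trans (t-tPrefix N (≤-trans (+-monoʳ-< i k<) bound)) (sym (at-drop i P k))

take-length-++ : ∀ (xs ys : Word) → take (length xs) (xs ++ ys) ≡ xs
take-length-++ []       ys = refl
take-length-++ (x ∷ xs) ys = cong (x ∷_) (take-length-++ xs ys)

drop-length-++ : ∀ (xs ys : Word) → drop (length xs) (xs ++ ys) ≡ ys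
drop-length-++ []       ys = refl
drop-length-++ (x ∷ xs) ys = drop-length-++ xs ys

_InfixOf_ : Word → Word → Set
u InfixOf w = ∃[ xs ] ∃[ ys ] w ≡ xs ++ u ++ ys

Occurs : Word → Set
Occurs u = ∃[ N ] u InfixOf tPrefix N

Factor→Occurs : ∀ {u} → Factor u → Occurs u
Factor→Occurs {u} (i , eq) = i + m , take i P , drop m (drop i P) , (begin
  P                                                   ≡⟨ take++drop≡id i P ⟨
  take i P ++ drop i P                                ≡⟨ cong (take i P ++_) (take++drop≡id m (drop i P)) ⟨
  take i P ++ take m (drop i P) ++ drop m (drop i P)  ≡⟨ cong (λ v → take i P ++ v ++ drop m (drop i P)) u≡ ⟩
  take i P ++ u ++ drop m (drop i P)                  ∎)
  where
  open ≡-Reasoning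
  m : ℕ
  m = length u
  P : Word
  P = tPrefix (i + m)
  u≡ : take m (drop i P) ≡ u
  u≡ = trans (sym (slice-tPrefix (i + m) i m (<⇒≤ (length-tPrefix (i + m))))) eq

Occurs→Factor : ∀ {u} → Occurs u → Factor u
Occurs→Factor {u} (N , xs , ys , eq) = length xs , (begin
  slice (length xs) (length u)                          ≡⟨ slice-tPrefix N (length xs) (length u) bound ⟩
  take (length u) (drop (length xs) (tPrefix N))        ≡⟨ cong (take (length u) ∘ drop (length xs)) eq ⟩
  take (length u) (drop (length xs) (xs ++ u ++ ys))    ≡⟨ cong (take (length u)) (drop-length-++ xs (u ++ ys)) ⟩
  take (length u) (u ++ ys)                             ≡⟨ take-length-++ u ys ⟩
  u                                                     ∎)
  where
  open ≡-Reasoning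
  bound : length xs + length u ≤ length (tPrefix N)
  bound = subst (λ w → length xs + length u ≤ length w) (sym eq)
            (subst (length xs + length u ≤_) (sym (length-++ xs)) (+-monoʳ-≤ (length xs) (length-++-≤ˡ u)))

++-regroup : ∀ (xs u v ys : Word) → xs ++ (u ++ v) ++ ys ≡ (xs ++ u) ++ v ++ ys
++-regroup xs u v ys = trans (cong (xs ++_) (++-assoc u v ys)) (sym (++-assoc xs u (v ++ ys)))

InfixOf-trans : ∀ {u v w} → u InfixOf v → v InfixOf w → u InfixOf w
InfixOf-trans {u} (xs , ys , refl) (as , bs , refl) =
  as ++ xs , ys ++ bs , trans (++-regroup as xs (u ++ ys) bs) (cong ((as ++ xs) ++_) (++-assoc u ys bs))

InfixOf-τ : ∀ {u w} → u InfixOf w → τ u InfixOf τ w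
InfixOf-τ {u} (xs , ys , refl) =
  τ xs , τ ys , trans (concatMap-++ τL xs (u ++ ys)) (cong (τ xs ++_) (concatMap-++ τL u ys))

InfixOf-tPrefix-suc : ∀ {u} N → u InfixOf tPrefix N → u InfixOf tPrefix (suc N)
InfixOf-tPrefix-suc N inf with z , zs , eq ← tPrefix-suc N = InfixOf-trans inf ([] , z ∷ zs , eq)

Occurs-infix : ∀ {u v} → u InfixOf v → Occurs v → Occurs u
Occurs-infix inf (N , inf′) = N , InfixOf-trans inf inf′

Occurs-τ : ∀ {u} → Occurs u → Occurs (τ u)
Occurs-τ (N , inf) = suc N , InfixOf-τ inf

Occurs-∷ʳ : ∀ {u} → Occurs u → ∃[ z ] Occurs (u ∷ʳ z)
Occurs-∷ʳ {u} (N , xs , y ∷ ys , eq) = y , N , xs , ys , trans eq (cong (xs ++_) (sym (∷ʳ-++ u y ys)))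
Occurs-∷ʳ {u} (N , xs , [] , eq) with z , zs , eq′ ← tPrefix-suc N = z , suc N , xs , zs , (begin
  tPrefix (suc N)            ≡⟨ eq′ ⟩
  tPrefix N ++ z ∷ zs        ≡⟨ cong (_++ z ∷ zs) eq ⟩
  (xs ++ u ++ []) ++ z ∷ zs  ≡⟨ cong (λ v → (xs ++ v) ++ z ∷ zs) (++-identityʳ u) ⟩
  (xs ++ u) ++ z ∷ zs        ≡⟨ ++-assoc xs u (z ∷ zs) ⟩
  xs ++ u ++ z ∷ zs          ≡⟨ cong (xs ++_) (∷ʳ-++ u z zs) ⟨
  xs ++ (u ∷ʳ z) ++ zs       ∎)
  where open ≡-Reasoning

Occurs-τ∷ʳ0 : ∀ {u} → Occurs u → Occurs (τ u ∷ʳ a0)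
Occurs-τ∷ʳ0 {u} occ with z , occ′ ← Occurs-∷ʳ occ with w , eq ← τ-∷ z [] =
  Occurs-infix ([] , w , (begin
    τ (u ∷ʳ z)           ≡⟨ concatMap-++ τL u [ z ] ⟩
    τ u ++ τ [ z ]       ≡⟨ cong (τ u ++_) eq ⟩
    τ u ++ a0 ∷ w        ≡⟨ ∷ʳ-++ (τ u) a0 w ⟨
    (τ u ∷ʳ a0) ++ w     ∎)) (Occurs-τ occ′)
  where open ≡-Reasoning

Factor-infix : ∀ {xs u ys} → Factor (xs ++ u ++ ys) → Factor u
Factor-infix {xs} {u} {ys} = Occurs→Factor ∘ Occurs-infix (xs , ys , refl) ∘ Factor→Occurs

Factor-τ∷ʳ0 : ∀ {u} → Factor u → Factor (τ u ∷ʳ a0)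
Factor-τ∷ʳ0 = Occurs→Factor ∘ Occurs-τ∷ʳ0 ∘ Factor→Occurs

-- next c is the letter after the first 0 of τ(c)0, so in a τ-image a 0 followed by c starts
-- the block τ(prev c); for c = 0 that block is τ(2) = 0.
next prev : Letter → Letter
next a0 = a1
next a1 = a2
next a2 = a0
prev a0 = a2
prev a1 = a0
prev a2 = a1

prev-next : ∀ a → prev (next a) ≡ a
prev-next a0 = refl
prev-next a1 = refl
prev-next a2 = refl

next-prev : ∀ a → next (prev a) ≡ a
next-prev a0 = refl
next-prev a1 = refl
next-prev a2 = refl

next-injective : ∀ {a b} → next a ≡ next b → a ≡ b
next-injective {a} {b} eq = subst₂ _≡_ (prev-next a) (prev-next b) (cong prev eq)

prev-injective : ∀ {a b} → prev a ≡ prev b → a ≡ b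
prev-injective {a} {b} eq = subst₂ _≡_ (next-prev a) (next-prev b) (cong next eq)

τ-head : ∀ Y {c ys} → τ Y ≡ c ∷ ys → c ≡ a0
τ-head []      ()
τ-head (y ∷ Y) eq with w , eq′ ← τ-∷ y Y = ∷-injectiveˡ (trans (sym eq) eq′)

τ-prev : ∀ {e} Y → e ≢ a0 → τ (prev e ∷ Y) ≡ a0 ∷ e ∷ τ Y
τ-prev {a0} Y e≢0 = ⊥-elim (e≢0 refl)
τ-prev {a1} Y _   = refl
τ-prev {a2} Y _   = refl

τ-0c : ∀ Y {c ys} → τ Y ≡ a0 ∷ c ∷ ys → ∃[ Y′ ] Y ≡ prev c ∷ Y′
τ-0c []       ()
τ-0c (a0 ∷ Y) refl = Y , refl
τ-0c (a1 ∷ Y) refl = Y , refl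
τ-0c (a2 ∷ Y) eq with refl ← τ-head Y (∷-injectiveʳ eq) = Y , refl

data Cut (Y xs zs : Word) : Set where
  between : ∀ Y₁ Y₂ → Y ≡ Y₁ ++ Y₂ → xs ≡ τ Y₁ → zs ≡ τ Y₂ → Cut Y xs zs
  within  : ∀ Y₁ e Y₂ → e ≢ a0 → Y ≡ Y₁ ++ prev e ∷ Y₂ → xs ≡ τ Y₁ ∷ʳ a0 → zs ≡ e ∷ τ Y₂ →
            Cut Y xs zs

Cut-∷ : ∀ y {Y xs zs} → Cut Y xs zs → Cut (y ∷ Y) (τL y ++ xs) zs
Cut-∷ y (between Y₁ Y₂ eY ex ez) = between (y ∷ Y₁) Y₂ (cong (y ∷_) eY) (cong (τL y ++_) ex) ez
Cut-∷ y (within Y₁ e Y₂ e≢0 eY ex ez) =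
  within (y ∷ Y₁) e Y₂ e≢0 (cong (y ∷_) eY) (trans (cong (τL y ++_) ex) (sym (++-assoc (τL y) (τ Y₁) [ a0 ]))) ez

cut : ∀ Y xs zs → τ Y ≡ xs ++ zs → Cut Y xs zs
cut Y        []             zs eq   = between [] Y refl refl (sym eq)
cut []       (x ∷ xs)       zs ()
cut (a0 ∷ Y) (x ∷ [])       zs refl = within [] a1 Y (λ ()) refl refl refl
cut (a1 ∷ Y) (x ∷ [])       zs refl = within [] a2 Y (λ ()) refl refl refl
cut (a0 ∷ Y) (x ∷ x′ ∷ xs) zs eq
  with refl , eq′ ← ∷-injective eq
  with refl , eq″ ← ∷-injective eq′ = Cut-∷ a0 (cut Y xs zs eq″)
cut (a1 ∷ Y) (x ∷ x′ ∷ xs) zs eq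
  with refl , eq′ ← ∷-injective eq
  with refl , eq″ ← ∷-injective eq′ = Cut-∷ a1 (cut Y xs zs eq″)
cut (a2 ∷ Y) (x ∷ xs)       zs eq
  with refl , eq′ ← ∷-injective eq = Cut-∷ a2 (cut Y xs zs eq′)

τ-image-0c : ∀ Y xs c ys → τ Y ≡ xs ++ a0 ∷ c ∷ ys → ∃[ Y₁ ] ∃[ Y₂ ] (Y ≡ Y₁ ++ prev c ∷ Y₂ × τ Y₁ ≡ xs)
τ-image-0c Y xs c ys eq with cut Y xs (a0 ∷ c ∷ ys) eq
... | within _ _ _ e≢0 _ _ ez = ⊥-elim (e≢0 (sym (∷-injectiveˡ ez)))
... | between Y₁ Y₂ eY ex ez with Y₂′ , refl ← τ-0c Y₂ (sym ez) = Y₁ , Y₂′ , eY , sym ex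

τ-image-after-nonzero : ∀ Y xs x c ys → τ Y ≡ xs ++ x ∷ c ∷ ys → x ≢ a0 → c ≡ a0
τ-image-after-nonzero Y xs x c ys eq x≢0 with cut Y xs (x ∷ c ∷ ys) eq
... | between _ Y₂ _ _ ez       = ⊥-elim (x≢0 (τ-head Y₂ (sym ez)))
... | within _ _ Y₂ _ _ _ ez    = τ-head Y₂ (sym (∷-injectiveʳ ez))

Suffix : Word → Word → Set
Suffix s w = ∃[ p ] w ≡ p ++ s

Suffix-refl : ∀ {w} → Suffix w w
Suffix-refl = [] , refl

Suffix-[] : ∀ {w} → Suffix [] w
Suffix-[] {w} = w , sym (++-identityʳ w)

Suffix-trans : ∀ {s v w} → Suffix s v → Suffix v w → Suffix s w
Suffix-trans {s} (p , refl) (q , refl) = q ++ p , sym (++-assoc q p s)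

Suffix-τ : ∀ {s w} → Suffix s w → Suffix (τ s) (τ w)
Suffix-τ {s} (p , refl) = τ p , concatMap-++ τL p s

Suffix-∷ʳ : ∀ {s w x} → Suffix s w → Suffix (s ∷ʳ x) (w ∷ʳ x)
Suffix-∷ʳ {s} {x = x} (p , refl) = p , ++-assoc p s [ x ]

++-cancelˡ-length : ∀ (p₁ p₂ : Word) {s₁ s₂} → p₁ ++ s₁ ≡ p₂ ++ s₂ → length s₁ ≡ length s₂ → s₁ ≡ s₂
++-cancelˡ-length []       []       eq   _ = eq
++-cancelˡ-length (_ ∷ p₁) (_ ∷ p₂) eq   l = ++-cancelˡ-length p₁ p₂ (∷-injectiveʳ eq) l
++-cancelˡ-length []       (_ ∷ p₂) {s₂ = s₂} refl l =
  ⊥-elim (m≢1+n+m (length s₂) (trans (sym l) (cong suc (length-++ p₂))))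
++-cancelˡ-length (_ ∷ p₁) []       {s₁} refl l =
  ⊥-elim (m≢1+n+m (length s₁) (trans l (cong suc (length-++ p₁))))

Suffix-unique : ∀ {s₁ s₂ w} → Suffix s₁ w → Suffix s₂ w → length s₁ ≡ length s₂ → s₁ ≡ s₂
Suffix-unique (p₁ , eq₁) (p₂ , eq₂) = ++-cancelˡ-length p₁ p₂ (trans (sym eq₁) eq₂)

-- A leading 1 or 2 is read as the tail of the block τ(0) = 01 or τ(1) = 02.
τ⁻¹ : Word → Word
τ⁻¹ []            = []
τ⁻¹ (a0 ∷ [])     = a2 ∷ []
τ⁻¹ (a0 ∷ a0 ∷ v) = a2 ∷ τ⁻¹ (a0 ∷ v)
τ⁻¹ (a0 ∷ a1 ∷ v) = a0 ∷ τ⁻¹ v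
τ⁻¹ (a0 ∷ a2 ∷ v) = a1 ∷ τ⁻¹ v
τ⁻¹ (a1 ∷ v)      = a0 ∷ τ⁻¹ v
τ⁻¹ (a2 ∷ v)      = a1 ∷ τ⁻¹ v

τ⁻¹-τ : ∀ Y → τ⁻¹ (τ Y) ≡ Y
τ⁻¹-τ []            = refl
τ⁻¹-τ (a0 ∷ Y)      = cong (a0 ∷_) (τ⁻¹-τ Y)
τ⁻¹-τ (a1 ∷ Y)      = cong (a1 ∷_) (τ⁻¹-τ Y)
τ⁻¹-τ (a2 ∷ [])     = refl
τ⁻¹-τ (a2 ∷ a0 ∷ Y) = cong (a2 ∷_) (τ⁻¹-τ (a0 ∷ Y))
τ⁻¹-τ (a2 ∷ a1 ∷ Y) = cong (a2 ∷_) (τ⁻¹-τ (a1 ∷ Y))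
τ⁻¹-τ (a2 ∷ a2 ∷ Y) = cong (a2 ∷_) (τ⁻¹-τ (a2 ∷ Y))

τ⁻¹-nonzero : ∀ {e} v → e ≢ a0 → τ⁻¹ (e ∷ v) ≡ prev e ∷ τ⁻¹ v
τ⁻¹-nonzero {a0} v e≢0 = ⊥-elim (e≢0 refl)
τ⁻¹-nonzero {a1} v _   = refl
τ⁻¹-nonzero {a2} v _   = refl

length-τ⁻¹-< : ∀ v x → length (τ⁻¹ v) < length (v ∷ʳ x)
length-τ⁻¹-< []            x = s≤s z≤n
length-τ⁻¹-< (a0 ∷ [])     x = s≤s (s≤s z≤n)
length-τ⁻¹-< (a0 ∷ a0 ∷ v) x = s≤s (length-τ⁻¹-< (a0 ∷ v) x)
length-τ⁻¹-< (a0 ∷ a1 ∷ v) x = s≤s (m<n⇒m<1+n (length-τ⁻¹-< v x))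
length-τ⁻¹-< (a0 ∷ a2 ∷ v) x = s≤s (m<n⇒m<1+n (length-τ⁻¹-< v x))
length-τ⁻¹-< (a1 ∷ v)      x = s≤s (length-τ⁻¹-< v x)
length-τ⁻¹-< (a2 ∷ v)      x = s≤s (length-τ⁻¹-< v x)

τ⁻¹-suffix : ∀ Y xs v → τ Y ≡ xs ++ v → Suffix (τ⁻¹ v) Y × Suffix v (τ (τ⁻¹ v))
τ⁻¹-suffix Y xs v eq with cut Y xs v eq
... | between Y₁ Y₂ eY _ refl rewrite τ⁻¹-τ Y₂ = (Y₁ , eY) , Suffix-refl
... | within Y₁ e Y₂ e≢0 eY _ refl rewrite τ⁻¹-nonzero (τ Y₂) e≢0 | τ⁻¹-τ Y₂ =
  (Y₁ , eY) , a0 ∷ [] , τ-prev Y₂ e≢0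

Factor-desubst : ∀ v c → Factor (v ++ a0 ∷ c ∷ []) → Factor (τ⁻¹ v ∷ʳ prev c) × Suffix v (τ (τ⁻¹ v))
Factor-desubst v c F
  with N , inf ← Factor→Occurs F
  with xs , ys , eq ← InfixOf-tPrefix-suc N inf
  with Y₁ , Y₂ , eY , eτ ← τ-image-0c (tPrefix N) (xs ++ v) c ys (trans eq (++-regroup xs v (a0 ∷ c ∷ []) ys))
  with (p , refl) , S ← τ⁻¹-suffix Y₁ xs v eτ
  = Occurs→Factor (N , p , Y₂ , trans eY (sym (++-regroup p (τ⁻¹ v) [ prev c ] Y₂))) , S

Factor-after-nonzero : ∀ q x c → Factor (q ++ x ∷ c ∷ []) → x ≢ a0 → c ≡ a0
Factor-after-nonzero q x c F
  with N , inf ← Factor→Occurs F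
  with xs , ys , eq ← InfixOf-tPrefix-suc N inf
  = τ-image-after-nonzero (tPrefix N) (xs ++ q) x c ys (trans eq (++-regroup xs q (x ∷ c ∷ []) ys))

block-next : ∀ c → ∃[ rest ] τ [ c ] ∷ʳ a0 ≡ a0 ∷ next c ∷ rest
block-next a0 = _ , refl
block-next a1 = _ , refl
block-next a2 = _ , refl

Factor-τ∷ʳ0-next : ∀ {r c} → Factor (r ∷ʳ c) → Factor ((τ r ∷ʳ a0) ∷ʳ next c)
Factor-τ∷ʳ0-next {r} {c} F with rest , eq ← block-next c =
  Factor-infix {xs = []} {ys = rest} (subst Factor (begin
    τ (r ∷ʳ c) ∷ʳ a0                   ≡⟨ cong (_∷ʳ a0) (concatMap-++ τL r [ c ]) ⟩
    (τ r ++ τ [ c ]) ∷ʳ a0             ≡⟨ ++-assoc (τ r) (τ [ c ]) [ a0 ] ⟩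
    τ r ++ (τ [ c ] ∷ʳ a0)             ≡⟨ cong (τ r ++_) eq ⟩
    τ r ++ a0 ∷ next c ∷ rest          ≡⟨ ∷ʳ-++ (τ r) a0 (next c ∷ rest) ⟨
    (τ r ∷ʳ a0) ++ next c ∷ rest       ≡⟨ ∷ʳ-++ (τ r ∷ʳ a0) (next c) rest ⟨
    ((τ r ∷ʳ a0) ∷ʳ next c) ++ rest    ∎) (Factor-τ∷ʳ0 F))
  where open ≡-Reasoning

RightSpecial-τ∷ʳ0 : ∀ {r} → RightSpecial r → RightSpecial (τ r ∷ʳ a0)
RightSpecial-τ∷ʳ0 (a , b , a≢b , Fa , Fb) =
  next a , next b , a≢b ∘ next-injective , Factor-τ∷ʳ0-next Fa , Factor-τ∷ʳ0-next Fb

¬RightSpecial-nonzero : ∀ v {x} → x ≢ a0 → ¬ RightSpecial (v ∷ʳ x)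
¬RightSpecial-nonzero v {x} x≢0 (a , b , a≢b , Fa , Fb) = a≢b (trans (after Fa) (sym (after Fb)))
  where
  after : ∀ {c} → Factor ((v ∷ʳ x) ∷ʳ c) → c ≡ a0
  after {c} F = Factor-after-nonzero v x c (subst Factor (++-assoc v [ x ] [ c ]) F) x≢0

RightSpecial-last : ∀ v x → RightSpecial (v ∷ʳ x) → x ≡ a0
RightSpecial-last v a0 _  = refl
RightSpecial-last v a1 rs = ⊥-elim (¬RightSpecial-nonzero v (λ ()) rs)
RightSpecial-last v a2 rs = ⊥-elim (¬RightSpecial-nonzero v (λ ()) rs)

RightSpecial-desubst : ∀ v x → RightSpecial (v ∷ʳ x) →
                       RightSpecial (τ⁻¹ v) × Suffix (v ∷ʳ x) (τ (τ⁻¹ v) ∷ʳ a0)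
RightSpecial-desubst v x rs@(a , b , a≢b , Fa , Fb) with refl ← RightSpecial-last v x rs =
  (prev a , prev b , a≢b ∘ prev-injective , proj₁ (desubst Fa) , proj₁ (desubst Fb)) ,
  Suffix-∷ʳ (proj₂ (desubst Fa))
  where
  desubst : ∀ {c} → Factor ((v ∷ʳ a0) ∷ʳ c) → Factor (τ⁻¹ v ∷ʳ prev c) × Suffix v (τ (τ⁻¹ v))
  desubst {c} F = Factor-desubst v c (subst Factor (++-assoc v [ a0 ] [ c ]) F)

RightSpecial-nested : ∀ w₁ w₂ → Acc _<_ (length w₁ + length w₂) → RightSpecial w₁ → RightSpecial w₂ →
                      ∃[ W ] (Suffix w₁ W × Suffix w₂ W)
RightSpecial-nested w₁ w₂ (acc rec) rs₁ rs₂ with initLast w₁ | initLast w₂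
... | []         | _          = w₂ , Suffix-[] , Suffix-refl
... | v₁ ∷ʳ′ x₁  | []         = v₁ ∷ʳ x₁ , Suffix-refl , Suffix-[]
... | v₁ ∷ʳ′ x₁  | v₂ ∷ʳ′ x₂
  with rs₁′ , S₁ ← RightSpecial-desubst v₁ x₁ rs₁
     | rs₂′ , S₂ ← RightSpecial-desubst v₂ x₂ rs₂
  with W , T₁ , T₂ ← RightSpecial-nested (τ⁻¹ v₁) (τ⁻¹ v₂)
                       (rec (+-mono-< (length-τ⁻¹-< v₁ x₁) (length-τ⁻¹-< v₂ x₂))) rs₁′ rs₂′
  = τ W ∷ʳ a0 , Suffix-trans S₁ (Suffix-∷ʳ (Suffix-τ T₁)) , Suffix-trans S₂ (Suffix-∷ʳ (Suffix-τ T₂))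

RightSpecial-unique : ∀ {w₁ w₂} → RightSpecial w₁ → RightSpecial w₂ → length w₁ ≡ length w₂ → w₁ ≡ w₂
RightSpecial-unique {w₁} {w₂} rs₁ rs₂ with W , S₁ , S₂ ← RightSpecial-nested w₁ w₂ (<-wellFounded _) rs₁ rs₂ =
  Suffix-unique S₁ S₂

count0-++ : ∀ xs ys → count0 (xs ++ ys) ≡ count0 xs + count0 ys
count0-++ []        ys = refl
count0-++ (a0 ∷ xs) ys = cong suc (count0-++ xs ys)
count0-++ (a1 ∷ xs) ys = count0-++ xs ys
count0-++ (a2 ∷ xs) ys = count0-++ xs ys

count1-++ : ∀ xs ys → count1 (xs ++ ys) ≡ count1 xs + count1 ys
count1-++ []        ys = refl
count1-++ (a0 ∷ xs) ys = count1-++ xs ys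
count1-++ (a1 ∷ xs) ys = cong suc (count1-++ xs ys)
count1-++ (a2 ∷ xs) ys = count1-++ xs ys

count2-++ : ∀ xs ys → count2 (xs ++ ys) ≡ count2 xs + count2 ys
count2-++ []        ys = refl
count2-++ (a0 ∷ xs) ys = count2-++ xs ys
count2-++ (a1 ∷ xs) ys = count2-++ xs ys
count2-++ (a2 ∷ xs) ys = cong suc (count2-++ xs ys)

count0-τ : ∀ w → count0 (τ w) ≡ length w
count0-τ []       = refl
count0-τ (a0 ∷ w) = cong suc (count0-τ w)
count0-τ (a1 ∷ w) = cong suc (count0-τ w)
count0-τ (a2 ∷ w) = cong suc (count0-τ w)

count1-τ : ∀ w → count1 (τ w) ≡ count0 w
count1-τ []       = refl
count1-τ (a0 ∷ w) = cong suc (count1-τ w)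
count1-τ (a1 ∷ w) = count1-τ w
count1-τ (a2 ∷ w) = count1-τ w

count2-τ : ∀ w → count2 (τ w) ≡ count1 w
count2-τ []       = refl
count2-τ (a0 ∷ w) = count2-τ w
count2-τ (a1 ∷ w) = cong suc (count2-τ w)
count2-τ (a2 ∷ w) = count2-τ w

Ψ-τ∷ʳ0 : ∀ w → Ψ (τ w ∷ʳ a0) ≡ (length w + 1 , count0 w , count1 w)
Ψ-τ∷ʳ0 w = cong₂ _,_ (trans (count0-++ (τ w) [ a0 ]) (cong (_+ 1) (count0-τ w)))
          (cong₂ _,_ (trans (count1-++ (τ w) [ a0 ]) (trans (+-identityʳ _) (count1-τ w)))
                     (trans (count2-++ (τ w) [ a0 ]) (trans (+-identityʳ _) (count2-τ w))))

Ψ-τ-tail : ∀ {u w} → τ u ≡ a0 ∷ w → count0 w + 1 ≡ length u × count1 w ≡ count0 u × count2 w ≡ count1 u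
Ψ-τ-tail {u} {w} eq =
  trans (+-comm (count0 w) 1) (trans (cong count0 (sym eq)) (count0-τ u)) ,
  trans (cong count1 (sym eq)) (count1-τ u) ,
  trans (cong count2 (sym eq)) (count2-τ u)

length-Ψ : ∀ w → length w ≡ count0 w + count1 w + count2 w
length-Ψ []       = refl
length-Ψ (a0 ∷ w) = cong suc (length-Ψ w)
length-Ψ (a1 ∷ w) = trans (cong suc (length-Ψ w)) (cong (_+ count2 w) (sym (+-suc (count0 w) (count1 w))))
length-Ψ (a2 ∷ w) = trans (cong suc (length-Ψ w)) (sym (+-suc (count0 w + count1 w) (count2 w)))

InB-total : ∀ {i j k x y z} → InB (i , j , k) (x , y , z) → x + y + z ≡ i + j + k + 1
InB-total {j = j} {k} {x} (inj₁ (refl , refl , refl))      = solve (x ∷ j ∷ k ∷ [])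
InB-total {i} {k = k} {y = y} (inj₂ (inj₁ (refl , refl , refl))) = solve (i ∷ y ∷ k ∷ [])
InB-total {i} {j} {z = z} (inj₂ (inj₂ (refl , refl , refl))) = solve (i ∷ j ∷ z ∷ [])

InB-length : ∀ {r u} → InB (Ψ r) (Ψ u) → length u ≡ length r + 1
InB-length {r} {u} u∈B = begin
  length u                              ≡⟨ length-Ψ u ⟩
  count0 u + count1 u + count2 u        ≡⟨ InB-total u∈B ⟩
  count0 r + count1 r + count2 r + 1    ≡⟨ cong (_+ 1) (length-Ψ r) ⟨
  length r + 1                          ∎
  where open ≡-Reasoning

InB-τ∷ʳ0 : ∀ r u → Factor u → InB (Ψ r) (Ψ u) → ∃[ u′ ] (Factor u′ × InB (Ψ (τ r ∷ʳ a0)) (Ψ u′))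
InB-τ∷ʳ0 r u Fu u∈B@(inj₁ (x , y , _)) =
  τ u ∷ʳ a0 , Factor-τ∷ʳ0 Fu ,
  subst₂ InB (sym (Ψ-τ∷ʳ0 r)) (sym (Ψ-τ∷ʳ0 u)) (inj₂ (inj₁ (cong (_+ 1) (InB-length {r} {u} u∈B) , x , y)))
InB-τ∷ʳ0 r u Fu u∈B@(inj₂ (inj₁ (x , y , _))) =
  τ u ∷ʳ a0 , Factor-τ∷ʳ0 Fu ,
  subst₂ InB (sym (Ψ-τ∷ʳ0 r)) (sym (Ψ-τ∷ʳ0 u)) (inj₂ (inj₂ (cong (_+ 1) (InB-length {r} {u} u∈B) , x , y)))
InB-τ∷ʳ0 r [] Fu (inj₂ (inj₂ (x , _ , _))) = ⊥-elim (m+1+n≢0 (count0 r) (sym x))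
InB-τ∷ʳ0 r (c ∷ u) Fu u∈B@(inj₂ (inj₂ (x , y , _)))
  with w , eq ← τ-∷ c u
  with c₀ , c₁ , c₂ ← Ψ-τ-tail {c ∷ u} eq =
  w , Factor-infix {xs = [ a0 ]} {ys = [ a0 ]} (subst (λ v → Factor (v ∷ʳ a0)) eq (Factor-τ∷ʳ0 Fu)) ,
  subst (λ p → InB p (Ψ w)) (sym (Ψ-τ∷ʳ0 r)) (inj₁ (trans c₀ (InB-length {r} {c ∷ u} u∈B) , trans c₁ x , trans c₂ y))

InB⇒MeetsB : ∀ {w u} → Factor u → InB (Ψ w) (Ψ u) → MeetsB (length w + 1) w
InB⇒MeetsB {w} {u} Fu u∈B = u , Fu , InB-length {w} {u} u∈B , u∈B

lemma6 : (n : ℕ) → 1 ≤ n → (r : Word) → RightSpecial r → length r ≡ n ∸ 1 →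
         MeetsB n r →
         (r′ : Word) → RightSpecial r′ → length r′ ≡ φ r ∸ 1 →
         MeetsB (φ r) r′
lemma6 _ _ r rs _ (u , Fu , _ , u∈B) r′ rs′ |r′| = subst (MeetsB (φ r)) (sym r′≡R) meetsR
  where
  R : Word
  R = τ r ∷ʳ a0
  r′≡R : r′ ≡ R
  r′≡R = RightSpecial-unique {r′} {R} rs′ (RightSpecial-τ∷ʳ0 {r} rs) (trans |r′| (m+n∸n≡m (length R) 1))
  meetsR : MeetsB (φ r) R
  meetsR with u′ , Fu′ , u′∈B ← InB-τ∷ʳ0 r u Fu u∈B = InB⇒MeetsB {R} {u′} Fu′ u′∈B
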